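{- Let $V$ be a finite vertex set and $E:V\times V\to\mathbb{R}_{\ge 0}$ a (finite) weight function on ordered pairs with $E(i,i)=0$ for all $i$, viewed as a complete weighted directed graph; let $T\subseteq V$. For $S\subseteq T$, $u\in V$ and an integer $d\ge 1$, let $f(S,u,d)$ be the minimum weight of a directed sub-tree of $(V,E)$ rooted at $u$ (edges directed away from $u$) such that every vertex of $S$ is reachable from $u$ using at most $d$ edges of the tree (for $S=\emptyset$ this minimum is $0$). Then for every integer $d\ge 2$, every non-empty $S\subseteq T$ and every $u\in V$, \[f(S,u,d)=\min \Big\{\min_{v \in V} \big\{ E(u, v) + f(S\setminus \{u\}, v, d-1) \big\},\ \min_{\emptyset \neq S' \subsetneq S } \big\{ f(S',u,d)+f(S\setminus S',u,d) \big\} \Big\},\] where the second inner minimum is omitted when $|S|=1$.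
   Context: The weight of a sub-tree is the sum of the weights $E(x,y)$ of its directed edges $(x,y)$.
   Formalization: The weight function E takes non-negative rational values rather than values in $\mathbb{R}_{\ge 0}$. -}

module Defs where

open import Data.Nat as ℕ using (ℕ; zero; suc)
open import Data.Fin using (Fin; zero; suc)
import Data.Fin as Fin
open import Data.Fin.Subset using (Subset; _∈_; _∉_; _⊆_; _⊂_; _─_; _-_; Nonempty)
open import Data.Fin.Subset.Properties using (_∈?_)
open import Data.Rational using (ℚ; 0ℚ; _+_; _≤_)
open import Data.Product using (Σ; ∃; ∃-syntax; _×_; _,_)
open import Data.Sum using (_⊎_)
open import Relation.Nullary using (yes; no; ¬_)
open import Relation.Binary.PropositionalEquality using (_≡_)

Weights : ℕ → Set
Weights n = Fin n → Fin n → ℚ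

sumFin : ∀ {n} → (Fin n → ℚ) → ℚ
sumFin {zero}  g = 0ℚ
sumFin {suc n} g = g zero + sumFin (λ i → g (suc i))

-- A directed sub-tree (arborescence) of the complete digraph on Fin n,
-- rooted at u, edges directed away from u.  It is given by its vertex set,
-- a parent map (the tree edges are (parent x , x) for x ∈ vertices, x ≠ u)
-- and a depth function witnessing acyclicity: depth u = 0 and
-- depth x = 1 + depth (parent x) for every non-root tree vertex x.
-- depth x is then exactly the number of tree edges on the path from u to x.
record RootedTree (n : ℕ) (u : Fin n) : Set where
  field
    vertices  : Subset n
    parent    : Fin n → Fin n
    depth     : Fin n → ℕ
    root∈     : u ∈ vertices
    rootDepth : depth u ≡ 0
    parent∈   : ∀ x → x ∈ vertices → ¬ x ≡ u → parent x ∈ vertices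
    depthStep : ∀ x → x ∈ vertices → ¬ x ≡ u → depth x ≡ suc (depth (parent x))

open RootedTree public

treeWeight : ∀ {n} → Weights n → {u : Fin n} → RootedTree n u → ℚ
treeWeight {n} E {u} t = sumFin edgeW
  where
  edgeW : Fin n → ℚ
  edgeW x with x ∈? vertices t | x Fin.≟ u
  ... | yes _ | no _ = E (parent t x) x
  ... | _     | _    = 0ℚ

Reaches : ∀ {n} {u : Fin n} → RootedTree n u → Subset n → ℕ → Set
Reaches t S d = ∀ s → s ∈ S → (s ∈ vertices t) × (depth t s ℕ.≤ d)

IsMinTreeWeight : ∀ {n} → Weights n → Subset n → Fin n → ℕ → ℚ → Set
IsMinTreeWeight {n} E S u d w =
  (Σ (RootedTree n u) λ t → Reaches t S d × treeWeight E t ≡ w)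
  × (∀ (t : RootedTree n u) → Reaches t S d → w ≤ treeWeight E t)

RecurrenceHolds : ∀ {n} → Weights n → (Subset n → Fin n → ℕ → ℚ)
                  → Subset n → Fin n → ℕ → Set
RecurrenceHolds {n} E f S u d =
  (∀ (v : Fin n) → f S u d ≤ E u v + f (S - u) v (d ℕ.∸ 1))
  × (∀ (S' : Subset n) → Nonempty S' → S' ⊂ S → f S u d ≤ f S' u d + f (S ─ S') u d)
  × ((∃[ v ] f S u d ≡ E u v + f (S - u) v (d ℕ.∸ 1))
     ⊎ (∃[ S' ] Nonempty S' × S' ⊂ S × f S u d ≡ f S' u d + f (S ─ S') u d))

{-# OPTIONS --safe #-}
-- Adding the edge (u, v) above a tree rooted at v gives a tree rooted at u in
-- which every old vertex is at most one level deeper. Merging two trees rooted at u, each vertex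
-- keeping its parent from the tree that reaches it with fewer edges, gives a tree reaching every
-- vertex of either tree no deeper. With nonnegative weights neither construction is heavier than
-- its parts; both are trees because their parent maps strictly decrease a potential.
--
-- Take an optimal tree t for (S, u, d). If S ⊆ {u}, then t itself, with v = u, is a
-- candidate since E(u, u) = 0. Otherwise let c be the child of u above some s ∈ S ∖ {u} and B the
-- branch of t below c. If S ⊆ B, the subtree at c reaches S ∖ {u} within d − 1 edges and with the
-- edge (u, c) weighs at most t. Otherwise S' = S ∩ B is a proper nonempty subset of S, and t
-- splits into u + B, reaching S', and t − B, reaching S ∖ S'. By the upper bounds the candidate
-- found is exactly f(S, u, d).

module Submission where

open import Defs
open import Data.Nat using (ℕ; _≤_)
open import Data.Fin using (Fin)
open import Data.Fin.Subset using (Subset; _⊆_; Nonempty)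
open import Data.Rational using (ℚ; 0ℚ) renaming (_≤_ to _≤ℚ_)
open import Relation.Binary.PropositionalEquality using (_≡_)

open import Algebra.Bundles using (CommutativeMonoid)
open import Data.Empty using (⊥-elim)
open import Data.Fin using (zero; suc; _≟_)
open import Data.Fin.Properties using (any?)
open import Data.Fin.Subset using (_∈_; _∉_; _⊂_; _─_; _-_; _∪_; _∩_; ⁅_⁆; inside; outside)
open import Data.Fin.Subset.Properties
  using (_∈?_; _⊂?_; ⊆-trans; p⊆p∪q; q⊆p∪q; x∈p∪q⁺; x∈p∪q⁻; x∈p∩q⁺; x∈p∩q⁻; p∩q⊆p;
         x∈⁅x⁆; x∈⁅y⁆⇒x≡y; x∉⁅y⁆⇒x≢y; x∈p∧x∉q⇒x∈p─q; x∈p∧x≢y⇒x∈p-y; p─q⊆p)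
open import Data.Nat using (zero; suc; z≤n; s≤s; _<_; _∸_)
import Data.Nat as ℕ
import Data.Nat.Properties as ℕ
open import Data.Product using (∃-syntax; _×_; _,_; proj₁; proj₂)
open import Data.Rational using (_+_)
import Data.Rational.Properties as ℚ
open import Data.Sum using (_⊎_; inj₁; inj₂)
open import Data.Vec using (tabulate; _∷_; there)
open import Data.Vec.Properties using (lookup∘tabulate; lookup⇒[]=; []=⇒lookup)
open import Function using (_∘_)
open import Relation.Binary.PropositionalEquality
  using (_≢_; refl; sym; trans; cong; cong₂; subst; module ≡-Reasoning)
open import Relation.Nullary using (Dec; yes; no; does; ¬_; ¬?)
open import Relation.Nullary.Decidable using (_×-dec_; _⊎-dec_; dec-true)
open import Relation.Unary using (Pred; Decidable)

open import Algebra.Properties.CommutativeSemigroup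
  (CommutativeMonoid.commutativeSemigroup ℚ.+-0-commutativeMonoid) using (interchange)

p≤p+q : ∀ {p q} → 0ℚ ≤ℚ q → p ≤ℚ p + q
p≤p+q {p} {q} 0≤q = subst (_≤ℚ p + q) (ℚ.+-identityʳ p) (ℚ.+-monoʳ-≤ p 0≤q)

p≤q+p : ∀ {p q} → 0ℚ ≤ℚ q → p ≤ℚ q + p
p≤q+p {p} {q} 0≤q = subst (_≤ℚ q + p) (ℚ.+-identityˡ p) (ℚ.+-monoˡ-≤ p 0≤q)

sumFin-mono : ∀ {n} {g h : Fin n → ℚ} → (∀ x → g x ≤ℚ h x) → sumFin g ≤ℚ sumFin h
sumFin-mono {zero}  g≤h = ℚ.≤-refl
sumFin-mono {suc n} g≤h = ℚ.+-mono-≤ (g≤h zero) (sumFin-mono (g≤h ∘ suc))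

sumFin-+ : ∀ {n} (g h : Fin n → ℚ) → sumFin (λ x → g x + h x) ≡ sumFin g + sumFin h
sumFin-+ {zero}  g h = sym (ℚ.+-identityˡ 0ℚ)
sumFin-+ {suc n} g h =
  trans (cong (g zero + h zero +_) (sumFin-+ (g ∘ suc) (h ∘ suc))) (interchange (g zero) (h zero) _ _)

sumFin-zero : ∀ n → sumFin {n} (λ _ → 0ℚ) ≡ 0ℚ
sumFin-zero zero    = refl
sumFin-zero (suc n) = trans (cong (0ℚ +_) (sumFin-zero n)) (ℚ.+-identityˡ 0ℚ)

indicator : ∀ {n} → Fin n → ℚ → Fin n → ℚ
indicator zero    c zero    = c
indicator zero    c (suc x) = 0ℚ
indicator (suc v) c zero    = 0ℚ
indicator (suc v) c (suc x) = indicator v c x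

indicator-self : ∀ {n} (v : Fin n) c → indicator v c v ≡ c
indicator-self zero    c = refl
indicator-self (suc v) c = indicator-self v c

indicator-other : ∀ {n} {v x : Fin n} c → x ≢ v → indicator v c x ≡ 0ℚ
indicator-other {v = zero}  {zero}  c x≢v = ⊥-elim (x≢v refl)
indicator-other {v = zero}  {suc x} c x≢v = refl
indicator-other {v = suc v} {zero}  c x≢v = refl
indicator-other {v = suc v} {suc x} c x≢v = indicator-other c (x≢v ∘ cong suc)

sumFin-indicator : ∀ {n} (v : Fin n) c → sumFin (indicator v c) ≡ c
sumFin-indicator {suc n} zero    c = trans (cong (c +_) (sumFin-zero n)) (ℚ.+-identityʳ c)
sumFin-indicator {suc n} (suc v) c = trans (ℚ.+-identityˡ _) (sumFin-indicator v c)

sumFin-indicator-+ : ∀ {n} (v : Fin n) c (g : Fin n → ℚ) →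
                     sumFin (λ x → indicator v c x + g x) ≡ c + sumFin g
sumFin-indicator-+ v c g = trans (sumFin-+ (indicator v c) g) (cong (_+ sumFin g) (sumFin-indicator v c))

toSubset : ∀ {n ℓ} {P : Pred (Fin n) ℓ} → Decidable P → Subset n
toSubset P? = tabulate (does ∘ P?)

module _ {n ℓ} {P : Pred (Fin n) ℓ} (P? : Decidable P) {x : Fin n} where

  ∈-toSubset⁺ : P x → x ∈ toSubset P?
  ∈-toSubset⁺ Px = lookup⇒[]= x _ (trans (lookup∘tabulate _ x) (dec-true (P? x) Px))

  ∈-toSubset⁻ : x ∈ toSubset P? → P x
  ∈-toSubset⁻ x∈ with P? x | trans (sym (lookup∘tabulate (does ∘ P?) x)) ([]=⇒lookup x∈)
  ... | yes Px | _ = Px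
  ... | no _   | ()

x∈p─q⇒x∉q : ∀ {n} {p q : Subset n} {x} → x ∈ p ─ q → x ∉ q
x∈p─q⇒x∉q {p = _ ∷ p} {outside ∷ q} {zero}  _                    ()
x∈p─q⇒x∉q {p = _ ∷ p} {inside  ∷ q} {zero}  ()
x∈p─q⇒x∉q {p = _ ∷ p} {_       ∷ q} {suc x} (there x∈) (there x∈q) =
  x∈p─q⇒x∉q {p = p} x∈ x∈q

x∈p-y⇒x≢y : ∀ {n} {p : Subset n} {x y} → x ∈ p - y → x ≢ y
x∈p-y⇒x≢y x∈ = x∉⁅y⁆⇒x≢y (x∈p─q⇒x∉q x∈)

module _ {n} (E : Weights n) {u : Fin n} (t : RootedTree n u) where

  -- the summand of treeWeight E t, which Defs keeps local; unification recovers it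
  edgeWeight : Fin n → ℚ
  edgeWeight = proj₁ {B = λ g → treeWeight E t ≡ sumFin g} (_ , refl)

  edgeWeight-root : edgeWeight u ≡ 0ℚ
  edgeWeight-root with u ∈? vertices t | u ≟ u
  ... | yes _ | yes _   = refl
  ... | no  _ | _       = refl
  ... | yes _ | no  u≢u = ⊥-elim (u≢u refl)

  edgeWeight-∉ : ∀ {x} → x ∉ vertices t → edgeWeight x ≡ 0ℚ
  edgeWeight-∉ {x} x∉V with x ∈? vertices t | x ≟ u
  ... | yes x∈V | _ = ⊥-elim (x∉V x∈V)
  ... | no  _   | _ = refl

  edgeWeight-∈ : ∀ {x} → x ∈ vertices t → x ≢ u → edgeWeight x ≡ E (parent t x) x
  edgeWeight-∈ {x} x∈V x≢u with x ∈? vertices t | x ≟ u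
  ... | yes _   | no  _   = refl
  ... | yes _   | yes x≡u = ⊥-elim (x≢u x≡u)
  ... | no  x∉V | _       = ⊥-elim (x∉V x∈V)

  edgeWeight-nonneg : (∀ i j → 0ℚ ≤ℚ E i j) → ∀ x → 0ℚ ≤ℚ edgeWeight x
  edgeWeight-nonneg E≥0 x with x ∈? vertices t | x ≟ u
  ... | yes _ | no  _ = E≥0 _ _
  ... | yes _ | yes _ = ℚ.≤-refl
  ... | no  _ | _     = ℚ.≤-refl

edgeWeight-cong : ∀ {n} (E : Weights n) {u : Fin n} {t t' : RootedTree n u} {x} →
                  x ∈ vertices t → x ∈ vertices t' → parent t x ≡ parent t' x →
                  edgeWeight E t x ≡ edgeWeight E t' x
edgeWeight-cong E {u} {t} {t'} {x} x∈t x∈t' px≡ with x ∈? vertices t | x ∈? vertices t' | x ≟ u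
... | yes _   | yes _   | yes _ = refl
... | yes _   | yes _   | no  _ = cong (λ y → E y x) px≡
... | no  x∉t | _       | _     = ⊥-elim (x∉t x∈t)
... | yes _   | no  x∉t' | _    = ⊥-elim (x∉t' x∈t')

-- Depths are computed by following parents with fuel D x, which suffices since D strictly
-- decreases towards r.
module PotentialTree {n} {r : Fin n} (V : Subset n) (p : Fin n → Fin n) (D : Fin n → ℕ)
  (r∈V : r ∈ V) (p∈V : ∀ x → x ∈ V → x ≢ r → p x ∈ V)
  (D-decreasing : ∀ x → x ∈ V → x ≢ r → D (p x) < D x) where

  height : ℕ → Fin n → ℕ
  height zero    x = 0
  height (suc k) x with x ≟ r
  ... | yes _ = 0
  ... | no  _ = suc (height k (p x))

  height-root : ∀ k → height k r ≡ 0
  height-root zero = refl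
  height-root (suc k) with r ≟ r
  ... | yes _   = refl
  ... | no  r≢r = ⊥-elim (r≢r refl)

  height-step : ∀ k {x} → x ≢ r → height (suc k) x ≡ suc (height k (p x))
  height-step k {x} x≢r with x ≟ r
  ... | yes x≡r = ⊥-elim (x≢r x≡r)
  ... | no  _   = refl

  height-≤ : ∀ k x → height k x ≤ k
  height-≤ zero    x = z≤n
  height-≤ (suc k) x with x ≟ r
  ... | yes _ = z≤n
  ... | no  _ = s≤s (height-≤ k (p x))

  height-stable : ∀ k k' {x} → x ∈ V → D x ≤ k → D x ≤ k' → height k x ≡ height k' x
  height-stable k k' {x} x∈V _ _ with x ≟ r
  ... | yes refl = trans (height-root k) (sym (height-root k'))
  height-stable zero _ {x} x∈V Dx≤0 _ | no x≢r =
    ⊥-elim (ℕ.n≮0 (ℕ.<-≤-trans (D-decreasing x x∈V x≢r) Dx≤0))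
  height-stable (suc k) zero {x} x∈V _ Dx≤0 | no x≢r =
    ⊥-elim (ℕ.n≮0 (ℕ.<-≤-trans (D-decreasing x x∈V x≢r) Dx≤0))
  height-stable (suc k) (suc k') {x} x∈V Dx≤1+k Dx≤1+k' | no x≢r = begin
    height (suc k) x       ≡⟨ height-step k x≢r ⟩
    suc (height k (p x))   ≡⟨ cong suc (height-stable k k' (p∈V x x∈V x≢r) (fuel Dx≤1+k) (fuel Dx≤1+k')) ⟩
    suc (height k' (p x))  ≡⟨ height-step k' x≢r ⟨
    height (suc k') x      ∎
    where
    open ≡-Reasoning
    fuel : ∀ {m} → D x ≤ suc m → D (p x) ≤ m
    fuel Dx≤1+m = ℕ.s≤s⁻¹ (ℕ.<-≤-trans (D-decreasing x x∈V x≢r) Dx≤1+m)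

  depth-step : ∀ x → x ∈ V → x ≢ r → height (D x) x ≡ suc (height (D (p x)) (p x))
  depth-step x x∈V x≢r with D x | D-decreasing x x∈V x≢r
  ... | suc k | s≤s Dpx≤k =
    trans (height-step k x≢r) (cong suc (height-stable k (D (p x)) (p∈V x x∈V x≢r) Dpx≤k ℕ.≤-refl))

  tree : RootedTree n r
  tree = record
    { vertices  = V
    ; parent    = p
    ; depth     = λ x → height (D x) x
    ; root∈     = r∈V
    ; rootDepth = height-root (D r)
    ; parent∈   = p∈V
    ; depthStep = depth-step
    }

  depth-≤ : ∀ x → depth tree x ≤ D x
  depth-≤ x = height-≤ (D x) x

_⊑[_]_ : ∀ {n} {u v : Fin n} → RootedTree n u → ℕ → RootedTree n v → Set
t ⊑[ k ] t' = ∀ x → x ∈ vertices t → x ∈ vertices t' × depth t' x ≤ k ℕ.+ depth t x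

Reaches-⊑ : ∀ {n} {u v : Fin n} {t : RootedTree n u} {t' : RootedTree n v} {k S d} →
            t ⊑[ k ] t' → Reaches t S d → Reaches t' S (k ℕ.+ d)
Reaches-⊑ {k = k} t⊑t' R s s∈S with R s s∈S
... | s∈t , s≤d with t⊑t' s s∈t
...   | s∈t' , s≤k+s = s∈t' , ℕ.≤-trans s≤k+s (ℕ.+-monoʳ-≤ k s≤d)

module _ {n} {u : Fin n} where

  Reaches-split : ∀ {t : RootedTree n u} {S S' d} → Reaches t S' d → Reaches t (S ─ S') d → Reaches t S d
  Reaches-split {S' = S'} R₁ R₂ s s∈S with s ∈? S'
  ... | yes s∈S' = R₁ s s∈S'
  ... | no  s∉S' = R₂ s (x∈p∧x∉q⇒x∈p─q s∈S s∉S')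

  Reaches-withRoot : ∀ {v} {t : RootedTree n v} {t' : RootedTree n u} {S d} →
                     t ⊑[ 1 ] t' → Reaches t (S - u) d → Reaches t' S (suc d)
  Reaches-withRoot {t = t} {t'} {S} {d} t⊑t' R s s∈S with s ≟ u
  ... | yes refl = root∈ t' , subst (_≤ suc d) (sym (rootDepth t')) z≤n
  ... | no  s≢u  = Reaches-⊑ {t = t} {t'} t⊑t' R s (x∈p∧x≢y⇒x∈p-y s∈S s≢u)

  module _ (t : RootedTree n u) where

    restrict : (W : Subset n) → u ∈ W → W ⊆ vertices t →
               (∀ x → x ∈ W → x ≢ u → parent t x ∈ W) → RootedTree n u
    restrict W u∈W W⊆V W-closed = record
      { vertices  = W
      ; parent    = parent t
      ; depth     = depth t
      ; root∈     = u∈W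
      ; rootDepth = rootDepth t
      ; parent∈   = W-closed
      ; depthStep = λ x x∈W → depthStep t x (W⊆V x∈W)
      }

    depth≡0⇒root : ∀ {x} → x ∈ vertices t → depth t x ≡ 0 → x ≡ u
    depth≡0⇒root {x} x∈V dx≡0 with x ≟ u
    ... | yes x≡u = x≡u
    ... | no  x≢u = ⊥-elim (ℕ.0≢1+n (trans (sym dx≡0) (depthStep t x x∈V x≢u)))

    depth≡1⇒parent≡root : ∀ {x} → x ∈ vertices t → depth t x ≡ 1 → parent t x ≡ u
    depth≡1⇒parent≡root {x} x∈V dx≡1 =
      depth≡0⇒root (parent∈ t x x∈V x≢u) (ℕ.suc-injective (trans (sym (depthStep t x x∈V x≢u)) dx≡1))
      where
      x≢u : x ≢ u
      x≢u refl = ℕ.0≢1+n (trans (sym (rootDepth t)) dx≡1)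

    ancestor : ℕ → Fin n → Fin n
    ancestor zero    x = x
    ancestor (suc k) x = ancestor k (parent t x)

    ancestor-depth : ∀ k {x} → x ∈ vertices t → k ≤ depth t x →
                     ancestor k x ∈ vertices t × depth t (ancestor k x) ≡ depth t x ∸ k
    ancestor-depth zero    x∈V _ = x∈V , refl
    ancestor-depth (suc k) {x} x∈V k<dx with x ≟ u
    ... | yes refl = ⊥-elim (ℕ.n≮0 (subst (k <_) (rootDepth t) k<dx))
    ... | no  x≢u  = subst (λ m → y ∈ vertices t × depth t y ≡ m ∸ suc k) (sym dx≡)
                       (ancestor-depth k (parent∈ t x x∈V x≢u) (ℕ.s≤s⁻¹ (subst (suc k ≤_) dx≡ k<dx)))
      where
      y = ancestor k (parent t x)
      dx≡ = depthStep t x x∈V x≢u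

    branchRoot : Fin n → Fin n
    branchRoot x = ancestor (depth t x ∸ 1) x

    branchRoot-depth : ∀ {x} → x ∈ vertices t → x ≢ u → branchRoot x ∈ vertices t × depth t (branchRoot x) ≡ 1
    branchRoot-depth {x} x∈V x≢u with ancestor-depth (depth t x ∸ 1) x∈V (ℕ.m∸n≤m (depth t x) 1)
    ... | br∈V , d≡ = br∈V , trans d≡ (ℕ.m∸[m∸n]≡n 1≤dx)
      where
      1≤dx : 1 ≤ depth t x
      1≤dx = subst (1 ≤_) (sym (depthStep t x x∈V x≢u)) (s≤s z≤n)

    branchRoot-self : ∀ {x} → depth t x ≡ 1 → branchRoot x ≡ x
    branchRoot-self {x} dx≡1 = cong (λ k → ancestor (k ∸ 1) x) dx≡1

    branchRoot-parent : ∀ {x} → x ∈ vertices t → x ≢ u → parent t x ≢ u → branchRoot (parent t x) ≡ branchRoot x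
    branchRoot-parent {x} x∈V x≢u px≢u = begin
      ancestor (depth t (parent t x) ∸ 1) (parent t x)  ≡⟨ cong (λ k → ancestor (k ∸ 1) (parent t x)) dpx≡ ⟩
      ancestor (depth t (parent t (parent t x))) (parent t x)  ≡⟨ cong (λ k → ancestor k x) dpx≡ ⟨
      ancestor (depth t (parent t x)) x  ≡⟨ cong (λ k → ancestor (k ∸ 1) x) (depthStep t x x∈V x≢u) ⟨
      ancestor (depth t x ∸ 1) x  ∎
      where
      open ≡-Reasoning
      dpx≡ = depthStep t (parent t x) (parent∈ t x x∈V x≢u) px≢u

    module Branch {c : Fin n} (c∈V : c ∈ vertices t) (c-depth : depth t c ≡ 1) where

      InBranch : Fin n → Set
      InBranch x = x ∈ vertices t × x ≢ u × branchRoot x ≡ c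

      inBranch? : Decidable InBranch
      inBranch? x = x ∈? vertices t ×-dec ¬? (x ≟ u) ×-dec branchRoot x ≟ c

      B : Subset n
      B = toSubset inBranch?

      c≢u : c ≢ u
      c≢u refl = ℕ.0≢1+n (trans (sym (rootDepth t)) c-depth)

      c∈B : c ∈ B
      c∈B = ∈-toSubset⁺ inBranch? (c∈V , c≢u , branchRoot-self c-depth)

      u∉B : u ∉ B
      u∉B u∈B = proj₁ (proj₂ (∈-toSubset⁻ inBranch? u∈B)) refl

      B⊆V : B ⊆ vertices t
      B⊆V x∈B = proj₁ (∈-toSubset⁻ inBranch? x∈B)

      B-nonroot : ∀ {x} → x ∈ B → x ≢ u
      B-nonroot x∈B = proj₁ (proj₂ (∈-toSubset⁻ inBranch? x∈B))

      parent∈B : ∀ {x} → x ∈ B → parent t x ≢ u → parent t x ∈ B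
      parent∈B {x} x∈B px≢u with ∈-toSubset⁻ inBranch? x∈B
      ... | x∈V , x≢u , br≡c =
        ∈-toSubset⁺ inBranch?
          (parent∈ t x x∈V x≢u , px≢u , trans (branchRoot-parent x∈V x≢u px≢u) br≡c)

      parent∈B⇒∈B : ∀ {x} → x ∈ vertices t → x ≢ u → parent t x ∈ B → x ∈ B
      parent∈B⇒∈B {x} x∈V x≢u px∈B with ∈-toSubset⁻ inBranch? px∈B
      ... | _ , px≢u , br≡c =
        ∈-toSubset⁺ inBranch? (x∈V , x≢u , trans (sym (branchRoot-parent x∈V x≢u px≢u)) br≡c)

      -- a vertex whose parent is the root has depth 1, hence is its own branch root
      parent≢root : ∀ {x} → x ∈ B → x ≢ c → parent t x ≢ u
      parent≢root {x} x∈B x≢c px≡u with ∈-toSubset⁻ inBranch? x∈B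
      ... | x∈V , x≢u , br≡c = x≢c (trans (sym (branchRoot-self dx≡1)) br≡c)
        where
        dx≡1 : depth t x ≡ 1
        dx≡1 = trans (depthStep t x x∈V x≢u) (cong suc (trans (cong (depth t) px≡u) (rootDepth t)))

      subtree-step : ∀ x → x ∈ B → x ≢ c → depth t x ∸ 1 ≡ suc (depth t (parent t x) ∸ 1)
      subtree-step x x∈B x≢c = begin
        depth t x ∸ 1                 ≡⟨ cong (_∸ 1) (depthStep t x (B⊆V x∈B) (B-nonroot x∈B)) ⟩
        depth t px                    ≡⟨ dpx≡ ⟩
        suc (depth t (parent t px))   ≡⟨ cong (λ k → suc (k ∸ 1)) dpx≡ ⟨
        suc (depth t px ∸ 1)          ∎
        where
        open ≡-Reasoning
        px = parent t x
        dpx≡ = depthStep t px (B⊆V (parent∈B x∈B (parent≢root x∈B x≢c))) (parent≢root x∈B x≢c)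

      subtree : RootedTree n c
      subtree = record
        { vertices  = B
        ; parent    = parent t
        ; depth     = λ x → depth t x ∸ 1
        ; root∈     = c∈B
        ; rootDepth = cong (_∸ 1) c-depth
        ; parent∈   = λ x x∈B x≢c → parent∈B x∈B (parent≢root x∈B x≢c)
        ; depthStep = subtree-step
        }

      withBranch : RootedTree n u
      withBranch = restrict (⁅ u ⁆ ∪ B) (x∈p∪q⁺ (inj₁ (x∈⁅x⁆ u))) ⊆V closed
        where
        ⊆V : ⁅ u ⁆ ∪ B ⊆ vertices t
        ⊆V {x} x∈ with x∈p∪q⁻ ⁅ u ⁆ B x∈
        ... | inj₁ x∈⁅u⁆ = subst (_∈ vertices t) (sym (x∈⁅y⁆⇒x≡y u x∈⁅u⁆)) (root∈ t)
        ... | inj₂ x∈B   = B⊆V x∈B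
        closed : ∀ x → x ∈ ⁅ u ⁆ ∪ B → x ≢ u → parent t x ∈ ⁅ u ⁆ ∪ B
        closed x x∈ x≢u with x∈p∪q⁻ ⁅ u ⁆ B x∈ | parent t x ≟ u
        ... | inj₁ x∈⁅u⁆ | _        = ⊥-elim (x≢u (x∈⁅y⁆⇒x≡y u x∈⁅u⁆))
        ... | inj₂ _     | yes px≡u = x∈p∪q⁺ (inj₁ (subst (_∈ ⁅ u ⁆) (sym px≡u) (x∈⁅x⁆ u)))
        ... | inj₂ x∈B   | no  px≢u = x∈p∪q⁺ (inj₂ (parent∈B x∈B px≢u))

      withoutBranch : RootedTree n u
      withoutBranch = restrict (vertices t ─ B) (x∈p∧x∉q⇒x∈p─q (root∈ t) u∉B) (p─q⊆p _ _) closed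
        where
        closed : ∀ x → x ∈ vertices t ─ B → x ≢ u → parent t x ∈ vertices t ─ B
        closed x x∈ x≢u = x∈p∧x∉q⇒x∈p─q (parent∈ t x x∈V x≢u)
                            (λ px∈B → x∈p─q⇒x∉q x∈ (parent∈B⇒∈B x∈V x≢u px∈B))
          where
          x∈V = p─q⊆p (vertices t) B x∈

module _ {n} (E : Weights n) (E≥0 : ∀ i j → 0ℚ ≤ℚ E i j) where

  module _ {u : Fin n} (t : RootedTree n u) {W : Subset n} {u∈W : u ∈ W} {W⊆V : W ⊆ vertices t}
           {W-closed : ∀ x → x ∈ W → x ≢ u → parent t x ∈ W} where

    edgeWeight-restrict-∈ : ∀ {x} → x ∈ W → edgeWeight E (restrict t W u∈W W⊆V W-closed) x ≡ edgeWeight E t x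
    edgeWeight-restrict-∈ x∈W = edgeWeight-cong E x∈W (W⊆V x∈W) refl

    edgeWeight-restrict-≤ : ∀ x → edgeWeight E (restrict t W u∈W W⊆V W-closed) x ≤ℚ edgeWeight E t x
    edgeWeight-restrict-≤ x = by-cases (x ∈? W)
      where
      -- `with x ∈? W` would also abstract the identical test hidden inside edgeWeight
      by-cases : Dec (x ∈ W) → edgeWeight E (restrict t W u∈W W⊆V W-closed) x ≤ℚ edgeWeight E t x
      by-cases (yes x∈W) = ℚ.≤-reflexive (edgeWeight-restrict-∈ x∈W)
      by-cases (no  x∉W) = subst (_≤ℚ _) (sym (edgeWeight-∉ E _ x∉W)) (edgeWeight-nonneg E t E≥0 x)

  module BranchWeight {u : Fin n} (t : RootedTree n u) {c : Fin n}
                      (c∈V : c ∈ vertices t) (c-depth : depth t c ≡ 1) where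
    open Branch t c∈V c-depth

    subtree-edge-≤ : ∀ {x} → x ≢ c → edgeWeight E subtree x ≤ℚ edgeWeight E t x
    subtree-edge-≤ {x} x≢c = by-cases (x ∈? B)
      where
      by-cases : Dec (x ∈ B) → edgeWeight E subtree x ≤ℚ edgeWeight E t x
      by-cases (yes x∈B) = ℚ.≤-reflexive (trans (edgeWeight-∈ E subtree x∈B x≢c)
                                               (sym (edgeWeight-∈ E t (B⊆V x∈B) (B-nonroot x∈B))))
      by-cases (no  x∉B) = subst (_≤ℚ _) (sym (edgeWeight-∉ E subtree x∉B)) (edgeWeight-nonneg E t E≥0 x)

    subtree-root-edge : edgeWeight E t c ≡ E u c
    subtree-root-edge = trans (edgeWeight-∈ E t c∈V c≢u) (cong (λ y → E y c) (depth≡1⇒parent≡root t c∈V c-depth))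

    subtree-pointwise : ∀ x → indicator c (E u c) x + edgeWeight E subtree x ≤ℚ edgeWeight E t x
    subtree-pointwise x = by-cases (x ≟ c)
      where
      open ℚ.≤-Reasoning
      by-cases : Dec (x ≡ c) → indicator c (E u c) x + edgeWeight E subtree x ≤ℚ edgeWeight E t x
      by-cases (yes refl) = begin
        indicator c (E u c) c + edgeWeight E subtree c  ≡⟨ cong₂ _+_ (indicator-self c (E u c))
                                                                     (edgeWeight-root E subtree) ⟩
        E u c + 0ℚ                                      ≡⟨ ℚ.+-identityʳ (E u c) ⟩
        E u c                                           ≡⟨ subtree-root-edge ⟨
        edgeWeight E t c                                ∎
      by-cases (no x≢c) = begin
        indicator c (E u c) x + edgeWeight E subtree x  ≡⟨ cong (_+ edgeWeight E subtree x)
                                                                (indicator-other (E u c) x≢c) ⟩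
        0ℚ + edgeWeight E subtree x                     ≡⟨ ℚ.+-identityˡ _ ⟩
        edgeWeight E subtree x                          ≤⟨ subtree-edge-≤ x≢c ⟩
        edgeWeight E t x                                ∎

    subtree-weight : E u c + treeWeight E subtree ≤ℚ treeWeight E t
    subtree-weight = begin
      E u c + treeWeight E subtree                                  ≡⟨ sumFin-indicator-+ c (E u c) _ ⟨
      sumFin (λ x → indicator c (E u c) x + edgeWeight E subtree x) ≤⟨ sumFin-mono subtree-pointwise ⟩
      treeWeight E t                                                ∎
      where open ℚ.≤-Reasoning

    withoutBranch-edge : ∀ {x} → x ∈ ⁅ u ⁆ ∪ B → edgeWeight E withoutBranch x ≡ 0ℚ
    withoutBranch-edge {x} x∈ with x∈p∪q⁻ ⁅ u ⁆ B x∈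
    ... | inj₁ x∈⁅u⁆ = trans (cong (edgeWeight E withoutBranch) (x∈⁅y⁆⇒x≡y u x∈⁅u⁆))
                             (edgeWeight-root E withoutBranch)
    ... | inj₂ x∈B   = edgeWeight-∉ E withoutBranch (λ x∈V─B → x∈p─q⇒x∉q x∈V─B x∈B)

    split-pointwise : ∀ x → edgeWeight E withBranch x + edgeWeight E withoutBranch x ≤ℚ edgeWeight E t x
    split-pointwise x = by-cases (x ∈? ⁅ u ⁆ ∪ B)
      where
      open ℚ.≤-Reasoning
      w₁ w₂ : ℚ
      w₁ = edgeWeight E withBranch x
      w₂ = edgeWeight E withoutBranch x
      by-cases : Dec (x ∈ ⁅ u ⁆ ∪ B) → w₁ + w₂ ≤ℚ edgeWeight E t x
      by-cases (yes x∈) = begin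
        w₁ + w₂                ≡⟨ cong₂ _+_ (edgeWeight-restrict-∈ t x∈) (withoutBranch-edge x∈) ⟩
        edgeWeight E t x + 0ℚ  ≡⟨ ℚ.+-identityʳ _ ⟩
        edgeWeight E t x       ∎
      by-cases (no x∉) = begin
        w₁ + w₂                ≡⟨ cong (_+ w₂) (edgeWeight-∉ E withBranch x∉) ⟩
        0ℚ + w₂                ≡⟨ ℚ.+-identityˡ w₂ ⟩
        w₂                     ≤⟨ edgeWeight-restrict-≤ t x ⟩
        edgeWeight E t x       ∎

    split-weight : treeWeight E withBranch + treeWeight E withoutBranch ≤ℚ treeWeight E t
    split-weight = ℚ.≤-trans (ℚ.≤-reflexive (sym (sumFin-+ (edgeWeight E withBranch) (edgeWeight E withoutBranch))))
                             (sumFin-mono split-pointwise)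

  module AdjoinRoot (u : Fin n) {v : Fin n} (t : RootedTree n v) where

    V : Subset n
    V = vertices t ∪ ⁅ u ⁆

    p : Fin n → Fin n
    p x with x ≟ v
    ... | yes _ = u
    ... | no  _ = parent t x

    D : Fin n → ℕ
    D x with x ≟ u
    ... | yes _ = 0
    ... | no  _ = suc (depth t x)

    u∈V : u ∈ V
    u∈V = x∈p∪q⁺ (inj₂ (x∈⁅x⁆ u))

    ∈t : ∀ {x} → x ∈ V → x ≢ u → x ∈ vertices t
    ∈t {x} x∈V x≢u with x∈p∪q⁻ (vertices t) ⁅ u ⁆ x∈V
    ... | inj₁ x∈t   = x∈t
    ... | inj₂ x∈⁅u⁆ = ⊥-elim (x≢u (x∈⁅y⁆⇒x≡y u x∈⁅u⁆))

    p-v : p v ≡ u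
    p-v with v ≟ v
    ... | yes _   = refl
    ... | no  v≢v = ⊥-elim (v≢v refl)

    p-other : ∀ {x} → x ≢ v → p x ≡ parent t x
    p-other {x} x≢v with x ≟ v
    ... | yes x≡v = ⊥-elim (x≢v x≡v)
    ... | no  _   = refl

    D-root : D u ≡ 0
    D-root with u ≟ u
    ... | yes _   = refl
    ... | no  u≢u = ⊥-elim (u≢u refl)

    D-≤ : ∀ x → D x ≤ suc (depth t x)
    D-≤ x with x ≟ u
    ... | yes _ = z≤n
    ... | no  _ = ℕ.≤-refl

    D-nonroot : ∀ {x} → x ≢ u → D x ≡ suc (depth t x)
    D-nonroot {x} x≢u with x ≟ u
    ... | yes x≡u = ⊥-elim (x≢u x≡u)
    ... | no  _   = refl

    p∈V : ∀ x → x ∈ V → x ≢ u → p x ∈ V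
    p∈V x x∈V x≢u with x ≟ v
    ... | yes _   = u∈V
    ... | no  x≢v = x∈p∪q⁺ (inj₁ (parent∈ t x (∈t x∈V x≢u) x≢v))

    D-decreasing : ∀ x → x ∈ V → x ≢ u → D (p x) < D x
    D-decreasing x x∈V x≢u = subst (D (p x) <_) (sym (D-nonroot x≢u)) (by-cases (x ≟ v))
      where
      by-cases : Dec (x ≡ v) → D (p x) < suc (depth t x)
      by-cases (yes refl) = subst (_< suc (depth t x)) (sym (trans (cong D p-v) D-root)) (s≤s z≤n)
      by-cases (no  x≢v)  = subst (_< suc (depth t x)) (sym (cong D (p-other x≢v)))
                              (s≤s (ℕ.≤-trans (D-≤ (parent t x))
                                              (ℕ.≤-reflexive (sym (depthStep t x (∈t x∈V x≢u) x≢v)))))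

    open PotentialTree V p D u∈V p∈V D-decreasing using (tree; depth-≤) public

    t⊑tree : t ⊑[ 1 ] tree
    t⊑tree x x∈t = x∈p∪q⁺ (inj₁ x∈t) , ℕ.≤-trans (depth-≤ x) (D-≤ x)

    tree-edge-v : edgeWeight E tree v ≤ℚ E u v
    tree-edge-v = by-cases (v ≟ u)
      where
      by-cases : Dec (v ≡ u) → edgeWeight E tree v ≤ℚ E u v
      by-cases (yes refl) = subst (_≤ℚ E v v) (sym (edgeWeight-root E tree)) (E≥0 v v)
      by-cases (no  v≢u)  = ℚ.≤-reflexive (trans (edgeWeight-∈ E tree (x∈p∪q⁺ (inj₁ (root∈ t))) v≢u)
                                                 (cong (λ y → E y v) p-v))

    tree-edge-other : ∀ {x} → x ≢ v → edgeWeight E tree x ≤ℚ edgeWeight E t x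
    tree-edge-other {x} x≢v = by-cases (x ≟ u) (x ∈? vertices t)
      where
      by-cases : Dec (x ≡ u) → Dec (x ∈ vertices t) → edgeWeight E tree x ≤ℚ edgeWeight E t x
      by-cases (yes refl) _         = subst (_≤ℚ _) (sym (edgeWeight-root E tree)) (edgeWeight-nonneg E t E≥0 x)
      by-cases (no  x≢u)  (yes x∈t) = ℚ.≤-reflexive (trans (edgeWeight-∈ E tree (x∈p∪q⁺ (inj₁ x∈t)) x≢u)
                                        (trans (cong (λ y → E y x) (p-other x≢v)) (sym (edgeWeight-∈ E t x∈t x≢v))))
      by-cases (no  x≢u)  (no  x∉t) = subst (_≤ℚ _) (sym (edgeWeight-∉ E tree (λ x∈V → x∉t (∈t x∈V x≢u))))
                                        (edgeWeight-nonneg E t E≥0 x)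

    tree-edge-≤ : ∀ x → edgeWeight E tree x ≤ℚ indicator v (E u v) x + edgeWeight E t x
    tree-edge-≤ x = by-cases (x ≟ v)
      where
      open ℚ.≤-Reasoning
      by-cases : Dec (x ≡ v) → edgeWeight E tree x ≤ℚ indicator v (E u v) x + edgeWeight E t x
      by-cases (yes refl) = begin
        edgeWeight E tree v                         ≤⟨ tree-edge-v ⟩
        E u v                                       ≡⟨ ℚ.+-identityʳ (E u v) ⟨
        E u v + 0ℚ                                  ≡⟨ cong₂ _+_ (indicator-self v (E u v)) (edgeWeight-root E t) ⟨
        indicator v (E u v) v + edgeWeight E t v    ∎
      by-cases (no  x≢v)  = begin
        edgeWeight E tree x                         ≤⟨ tree-edge-other x≢v ⟩
        edgeWeight E t x                            ≡⟨ ℚ.+-identityˡ _ ⟨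
        0ℚ + edgeWeight E t x                       ≡⟨ cong (_+ edgeWeight E t x) (indicator-other (E u v) x≢v) ⟨
        indicator v (E u v) x + edgeWeight E t x    ∎

    tree-weight : treeWeight E tree ≤ℚ E u v + treeWeight E t
    tree-weight = ℚ.≤-trans (sumFin-mono tree-edge-≤) (ℚ.≤-reflexive (sumFin-indicator-+ v (E u v) _))

  module Merge {u : Fin n} (t₁ t₂ : RootedTree n u) where

    V : Subset n
    V = vertices t₁ ∪ vertices t₂

    FromFirst : Fin n → Set
    FromFirst x = x ∈ vertices t₁ × (x ∉ vertices t₂ ⊎ depth t₁ x ≤ depth t₂ x)

    fromFirst? : Decidable FromFirst
    fromFirst? x = x ∈? vertices t₁ ×-dec (¬? (x ∈? vertices t₂) ⊎-dec depth t₁ x ℕ.≤? depth t₂ x)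

    source : Fin n → RootedTree n u
    source x with fromFirst? x
    ... | yes _ = t₁
    ... | no  _ = t₂

    source-∈ : ∀ {x} → x ∈ V → x ∈ vertices (source x)
    source-∈ {x} x∈V with fromFirst? x | x∈p∪q⁻ (vertices t₁) (vertices t₂) x∈V
    ... | yes (x∈₁ , _) | _        = x∈₁
    ... | no  _         | inj₂ x∈₂ = x∈₂
    ... | no  ¬first    | inj₁ x∈₁ with x ∈? vertices t₂
    ...   | yes x∈₂ = x∈₂
    ...   | no  x∉₂ = ⊥-elim (¬first (x∈₁ , inj₁ x∉₂))

    source-⊆ : ∀ x → vertices (source x) ⊆ V
    source-⊆ x with fromFirst? x
    ... | yes _ = p⊆p∪q (vertices t₂)
    ... | no  _ = q⊆p∪q (vertices t₁) (vertices t₂)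

    depth-source-≤₁ : ∀ {y} → y ∈ vertices t₁ → depth (source y) y ≤ depth t₁ y
    depth-source-≤₁ {y} y∈₁ with fromFirst? y
    ... | yes _ = ℕ.≤-refl
    ... | no  ¬first with depth t₁ y ℕ.≤? depth t₂ y
    ...   | yes d₁≤d₂ = ⊥-elim (¬first (y∈₁ , inj₂ d₁≤d₂))
    ...   | no  d₁≰d₂ = ℕ.<⇒≤ (ℕ.≰⇒> d₁≰d₂)

    depth-source-≤₂ : ∀ {y} → y ∈ vertices t₂ → depth (source y) y ≤ depth t₂ y
    depth-source-≤₂ {y} y∈₂ with fromFirst? y
    ... | yes (_ , inj₁ y∉₂)   = ⊥-elim (y∉₂ y∈₂)
    ... | yes (_ , inj₂ d₁≤d₂) = d₁≤d₂
    ... | no  _                = ℕ.≤-refl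

    depth-source-≤ : ∀ x {y} → y ∈ vertices (source x) → depth (source y) y ≤ depth (source x) y
    depth-source-≤ x with fromFirst? x
    ... | yes _ = depth-source-≤₁
    ... | no  _ = depth-source-≤₂

    p∈V : ∀ x → x ∈ V → x ≢ u → parent (source x) x ∈ V
    p∈V x x∈V x≢u = source-⊆ x (parent∈ (source x) x (source-∈ x∈V) x≢u)

    D-decreasing : ∀ x → x ∈ V → x ≢ u →
                   depth (source (parent (source x) x)) (parent (source x) x) < depth (source x) x
    D-decreasing x x∈V x≢u =
      ℕ.≤-<-trans (depth-source-≤ x (parent∈ (source x) x x∈s x≢u))
                  (ℕ.≤-reflexive (sym (depthStep (source x) x x∈s x≢u)))
      where
      x∈s = source-∈ x∈V

    open PotentialTree V (λ x → parent (source x) x) (λ x → depth (source x) x)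
                       (p⊆p∪q (vertices t₂) (root∈ t₁)) p∈V D-decreasing using (tree; depth-≤) public

    t₁⊑tree : t₁ ⊑[ 0 ] tree
    t₁⊑tree x x∈₁ = p⊆p∪q (vertices t₂) x∈₁ , ℕ.≤-trans (depth-≤ x) (depth-source-≤₁ x∈₁)

    t₂⊑tree : t₂ ⊑[ 0 ] tree
    t₂⊑tree x x∈₂ = q⊆p∪q (vertices t₁) (vertices t₂) x∈₂ , ℕ.≤-trans (depth-≤ x) (depth-source-≤₂ x∈₂)

    source-edge-≤ : ∀ x → edgeWeight E (source x) x ≤ℚ edgeWeight E t₁ x + edgeWeight E t₂ x
    source-edge-≤ x with fromFirst? x
    ... | yes _ = p≤p+q (edgeWeight-nonneg E t₂ E≥0 x)
    ... | no  _ = p≤q+p (edgeWeight-nonneg E t₁ E≥0 x)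

    tree-edge-≤ : ∀ x → edgeWeight E tree x ≤ℚ edgeWeight E t₁ x + edgeWeight E t₂ x
    tree-edge-≤ x = by-cases (x ∈? V)
      where
      by-cases : Dec (x ∈ V) → edgeWeight E tree x ≤ℚ edgeWeight E t₁ x + edgeWeight E t₂ x
      by-cases (yes x∈V) = subst (_≤ℚ _) (sym (edgeWeight-cong E x∈V (source-∈ x∈V) refl)) (source-edge-≤ x)
      by-cases (no  x∉V) = subst (_≤ℚ _) (sym (edgeWeight-∉ E tree x∉V))
                             (ℚ.≤-trans (edgeWeight-nonneg E t₁ E≥0 x) (p≤p+q (edgeWeight-nonneg E t₂ E≥0 x)))

    tree-weight : treeWeight E tree ≤ℚ treeWeight E t₁ + treeWeight E t₂
    tree-weight = ℚ.≤-trans (sumFin-mono tree-edge-≤) (ℚ.≤-reflexive (sumFin-+ (edgeWeight E t₁) (edgeWeight E t₂)))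

  data Decomposition (u : Fin n) (S : Subset n) (d : ℕ) (w : ℚ) : Set where
    root-edge : ∀ v (t : RootedTree n v) → Reaches t (S - u) d → E u v + treeWeight E t ≤ℚ w →
                Decomposition u S d w
    split     : ∀ S' → Nonempty S' → S' ⊂ S → (t₁ t₂ : RootedTree n u) →
                Reaches t₁ S' (suc d) → Reaches t₂ (S ─ S') (suc d) →
                treeWeight E t₁ + treeWeight E t₂ ≤ℚ w → Decomposition u S d w

  module DecomposeAtBranch {u : Fin n} {S : Subset n} {d : ℕ} (t : RootedTree n u) (R : Reaches t S (suc d))
                           {s : Fin n} (s∈S : s ∈ S) (s≢u : s ≢ u) where

    s∈V : s ∈ vertices t
    s∈V = proj₁ (R s s∈S)

    open Branch t (proj₁ (branchRoot-depth t s∈V s≢u)) (proj₂ (branchRoot-depth t s∈V s≢u))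
    open BranchWeight t (proj₁ (branchRoot-depth t s∈V s≢u)) (proj₂ (branchRoot-depth t s∈V s≢u))

    withBranch-reaches : Reaches withBranch (S ∩ B) (suc d)
    withBranch-reaches x x∈ with x∈p∩q⁻ S B x∈
    ... | x∈S , x∈B = x∈p∪q⁺ (inj₂ x∈B) , proj₂ (R x x∈S)

    withoutBranch-reaches : Reaches withoutBranch (S ─ S ∩ B) (suc d)
    withoutBranch-reaches x x∈ =
      x∈p∧x∉q⇒x∈p─q (proj₁ (R x x∈S)) (λ x∈B → x∈p─q⇒x∉q x∈ (x∈p∩q⁺ (x∈S , x∈B))) , proj₂ (R x x∈S)
      where
      x∈S = p─q⊆p S (S ∩ B) x∈

    subtree-reaches : ¬ (S ∩ B ⊂ S) → Reaches subtree (S - u) d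
    subtree-reaches ¬S∩B⊂S x x∈ = x∈B (x ∈? B) , ℕ.∸-monoˡ-≤ 1 (proj₂ (R x x∈S))
      where
      x∈S = p─q⊆p S ⁅ u ⁆ x∈
      x∈B : Dec (x ∈ B) → x ∈ B
      x∈B (yes x∈B) = x∈B
      x∈B (no  x∉B) = ⊥-elim (¬S∩B⊂S (p∩q⊆p S B , x , x∈S , x∉B ∘ proj₂ ∘ x∈p∩q⁻ S B))

    decomposition : Decomposition u S d (treeWeight E t)
    decomposition with S ∩ B ⊂? S
    ... | yes S∩B⊂S = split (S ∩ B) (s , x∈p∩q⁺ (s∈S , ∈-toSubset⁺ inBranch? (s∈V , s≢u , refl))) S∩B⊂S
                            withBranch withoutBranch withBranch-reaches withoutBranch-reaches split-weight
    ... | no ¬S∩B⊂S = root-edge (branchRoot t s) subtree (subtree-reaches ¬S∩B⊂S) subtree-weight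

  decompose : (∀ i → E i i ≡ 0ℚ) → ∀ {u S d} (t : RootedTree n u) → Reaches t S (suc d) →
              Decomposition u S d (treeWeight E t)
  decompose E-diag {u} {S} t R with any? (λ s → s ∈? S ×-dec ¬? (s ≟ u))
  ... | yes (s , s∈S , s≢u) = DecomposeAtBranch.decomposition t R s∈S s≢u
  ... | no  ∄s              = root-edge u t (λ s s∈ → ⊥-elim (∄s (s , p─q⊆p S ⁅ u ⁆ s∈ , x∈p-y⇒x≢y s∈)))
                                (ℚ.≤-reflexive (trans (cong (_+ treeWeight E t) (E-diag u)) (ℚ.+-identityˡ _)))

  extend-≤ : ∀ {S u v d w w'} → IsMinTreeWeight E S u (suc d) w → IsMinTreeWeight E (S - u) v d w' →
             w ≤ℚ E u v + w'
  extend-≤ {u = u} {v} {w = w} {w'} (_ , w-min) ((t , R , t≡w') , _) = begin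
    w                       ≤⟨ w-min tree (Reaches-withRoot {t = t} {tree} t⊑tree R) ⟩
    treeWeight E tree       ≤⟨ tree-weight ⟩
    E u v + treeWeight E t  ≡⟨ cong (E u v +_) t≡w' ⟩
    E u v + w'              ∎
    where
    open AdjoinRoot u t
    open ℚ.≤-Reasoning

  merge-≤ : ∀ {S S' u d w w₁ w₂} → IsMinTreeWeight E S u d w → IsMinTreeWeight E S' u d w₁ →
            IsMinTreeWeight E (S ─ S') u d w₂ → w ≤ℚ w₁ + w₂
  merge-≤ {S} {S'} {d = d} {w = w} {w₁} {w₂} (_ , w-min) ((t₁ , R₁ , t₁≡w₁) , _) ((t₂ , R₂ , t₂≡w₂) , _) = begin
    w                                  ≤⟨ w-min tree reaches ⟩
    treeWeight E tree                  ≤⟨ tree-weight ⟩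
    treeWeight E t₁ + treeWeight E t₂  ≡⟨ cong₂ _+_ t₁≡w₁ t₂≡w₂ ⟩
    w₁ + w₂                            ∎
    where
    open Merge t₁ t₂
    open ℚ.≤-Reasoning
    reaches : Reaches tree S d
    reaches = Reaches-split {t = tree} {S' = S'} (Reaches-⊑ {t = t₁} {tree} t₁⊑tree R₁)
                                                 (Reaches-⊑ {t = t₂} {tree} t₂⊑tree R₂)

  recurrence-attained : (∀ i → E i i ≡ 0ℚ) → ∀ {S u d w} {g : Fin n → ℚ} {h : Subset n → ℚ} →
    IsMinTreeWeight E S u (suc d) w →
    (∀ v → IsMinTreeWeight E (S - u) v d (g v)) →
    (∀ S' → S' ⊆ S → IsMinTreeWeight E S' u (suc d) (h S')) →
    (∃[ v ] w ≡ E u v + g v) ⊎ (∃[ S' ] Nonempty S' × S' ⊂ S × w ≡ h S' + h (S ─ S'))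
  recurrence-attained E-diag {S} {u} {w = w} {g} {h} w-min@((t , R , t≡w) , _) g-min h-min
    with decompose E-diag t R
  ... | root-edge v t' R' ≤t = inj₁ (v , ℚ.≤-antisym (extend-≤ w-min (g-min v)) (begin
    E u v + g v              ≤⟨ ℚ.+-monoʳ-≤ (E u v) (proj₂ (g-min v) t' R') ⟩
    E u v + treeWeight E t'  ≤⟨ ≤t ⟩
    treeWeight E t           ≡⟨ t≡w ⟩
    w                        ∎))
    where open ℚ.≤-Reasoning
  ... | split S' S'≢∅ S'⊂S t₁ t₂ R₁ R₂ ≤t =
    inj₂ (S' , S'≢∅ , S'⊂S , ℚ.≤-antisym (merge-≤ w-min h₁-min h₂-min) (begin
    h S' + h (S ─ S')                  ≤⟨ ℚ.+-mono-≤ (proj₂ h₁-min t₁ R₁) (proj₂ h₂-min t₂ R₂) ⟩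
    treeWeight E t₁ + treeWeight E t₂  ≤⟨ ≤t ⟩
    treeWeight E t                     ≡⟨ t≡w ⟩
    w                                  ∎))
    where
    open ℚ.≤-Reasoning
    h₁-min = h-min S' (proj₁ S'⊂S)
    h₂-min = h-min (S ─ S') (p─q⊆p S S')

lemma1 : (n : ℕ) (E : Weights n) (T : Subset n)
    → (∀ i j → 0ℚ ≤ℚ E i j)
    → (∀ i → E i i ≡ 0ℚ)
    → (f : Subset n → Fin n → ℕ → ℚ)
    → (∀ S u d → S ⊆ T → 1 ≤ d → IsMinTreeWeight E S u d (f S u d))
    → ∀ (d : ℕ) → 2 ≤ d → ∀ (S : Subset n) → S ⊆ T → Nonempty S → ∀ (u : Fin n)
    → RecurrenceHolds E f S u d
-- S = ∅ is covered by v = u.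
lemma1 n E T E≥0 E-diag f f-min (suc (suc d)) (s≤s (s≤s _)) S S⊆T _ u =
    (λ v → extend-≤ E E≥0 (isMin S⊆T) (isMin S-u⊆T))
  , (λ S' _ S'⊂S → merge-≤ E E≥0 (isMin S⊆T) (isMin (⊆-trans (proj₁ S'⊂S) S⊆T))
                                               (isMin (⊆-trans (p─q⊆p S S') S⊆T)))
  , recurrence-attained E E≥0 E-diag (isMin S⊆T) (λ v → isMin S-u⊆T) (λ S' S'⊆S → isMin (⊆-trans S'⊆S S⊆T))
  where
  isMin : ∀ {S' v k} → S' ⊆ T → IsMinTreeWeight E S' v (suc k) (f S' v (suc k))
  isMin {S'} {v} {k} S'⊆T = f-min S' v (suc k) S'⊆T (s≤s z≤n)

  S-u⊆T : S - u ⊆ T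
  S-u⊆T = ⊆-trans (p─q⊆p S ⁅ u ⁆) S⊆T
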